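{- Let $p$ be a prime and let $n,k$ be integers with $k>1$ and $n\geq k$. Then $$\int_{\mathbb Z_p}x^{n-k}(1-x)^{k}\,d\mu_1(x)=\sum_{l=0}^{n-k}\binom{n-k}{l}(-1)^{l}\left(B_{l+k}+l+k\right),$$ where $B_m$ is the $m$-th Bernoulli number.
   Context: $\mathbb Z_p$ denotes the ring of $p$-adic integers. For a uniformly differentiable function $f:\mathbb Z_p\to\mathbb C_p$, the bosonic $p$-adic integral (Volkenborn integral) is $\int_{\mathbb Z_p}f(x)\,d\mu_1(x)=\lim_{N\to\infty}\frac{1}{p^N}\sum_{x=0}^{p^N-1}f(x)$. The Bernoulli numbers are defined by $\frac{t}{e^t-1}=\sum_{m\geq0}B_m\frac{t^m}{m!}$; one has $\int_{\mathbb Z_p}x^m\,d\mu_1(x)=B_m$. -}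

module Defs where

open import Data.Nat as ℕ using (ℕ; zero; suc; _≤_; _≡ᵇ_)
open import Data.Nat.Divisibility using (_∣_)
open import Data.Nat.Combinatorics using (_C_)
open import Data.Integer as ℤ using (ℤ; +_)
open import Data.Rational as ℚ using (ℚ; 0ℚ; 1ℚ; _+_; _*_; _-_; -_)
open import Data.Nat.Properties using (m^n≢0)
open import Data.Bool using (if_then_else_)

ℕ→ℚ : ℕ → ℚ
ℕ→ℚ n = (+ n) ℚ./ 1

_^ℚ_ : ℚ → ℕ → ℚ
q ^ℚ zero  = 1ℚ
q ^ℚ suc m = q * (q ^ℚ m)

sgn : ℕ → ℚ
sgn l = (- 1ℚ) ^ℚ l

Σ< : ℕ → (ℕ → ℚ) → ℚ
Σ< zero    f = 0ℚ
Σ< (suc n) f = Σ< n f + f n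

-- Bernoulli numbers (convention t/(e^t-1), so B₁ = -1/2): the coefficients
-- B_m/m! of the formal power-series inverse of (e^t-1)/t, i.e.
--   B₀ = 1,  B_m = -(1/(m+1)) Σ_{j=0}^{m-1} C(m+1,j) B_j   (m ≥ 1).
-- bernTable m j = B_j for all j ≤ m.
bernTable : ℕ → ℕ → ℚ
bernTable zero    _ = 1ℚ
bernTable (suc m) j =
  if j ≡ᵇ suc m
  then - (((+ 1) ℚ./ (suc (suc m))) *
          Σ< (suc m) (λ i → ℕ→ℚ ((suc (suc m)) C i) * bernTable m i))
  else bernTable m j

bernoulli : ℕ → ℚ
bernoulli m = bernTable m m

-- |q|_p ≤ p^{-e} for a rational q (meaningful for e ≥ 1): since q is stored
-- in lowest terms, this holds iff p^e divides the numerator of q.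
PAdicSmall : ℕ → ℕ → ℚ → Set
PAdicSmall p e q = (p ℕ.^ e) ∣ ℤ.∣ ℚ.numerator q ∣

PAdicLimit : ℕ → (ℕ → ℚ) → ℚ → Set
PAdicLimit p a L = ∀ (e : ℕ) → Σ' ℕ (λ N₀ → ∀ N → N₀ ≤ N → PAdicSmall p e (a N - L))
  where
  open import Data.Product using () renaming (Σ to Σ')

volkenbornSum : (p : ℕ) → .{{ℕ.NonZero p}} → (ℕ → ℚ) → ℕ → ℚ
volkenbornSum p f N =
  ((+ 1) ℚ./ (p ℕ.^ N)) {{m^n≢0 p N}} * Σ< (p ℕ.^ N) f

-- ∫_{ℤ_p} f dμ₁ = L  (bosonic p-adic / Volkenborn integral); f is given by its
-- values on ℕ, which is dense in ℤ_p, so this determines a continuous f.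
VolkenbornIntegral : (p : ℕ) → .{{ℕ.NonZero p}} → (ℕ → ℚ) → ℚ → Set
VolkenbornIntegral p f L = PAdicLimit p (volkenbornSum p f) L

{-# OPTIONS --safe #-}
-- Let R_N f = p^(-N) Σ_{x<p^N} f(x). Telescoping (x+1)^(j+1) - x^(j+1) gives
-- Σ_{i≤j} C(j+1,i) R_N(x^i) = p^(Nj); the Bernoulli numbers satisfy the same triangular
-- recurrence with right-hand side 0^j = lim p^(Nj), so R_N(x^j) → B_j. Reversing the order of
-- summation, x ↦ p^N - 1 - x, turns (-x)^j into (x + 1 - p^N)^j ≡ (x+1)^j - j p^N (x+1)^(j-1)
-- (mod p^(2N)), whence ∫(-x)^j = ∫(x+1)^j = B_j for j ≥ 2; the shift x ↦ x + 1 then gives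
-- ∫(1-x)^j = ∫(-x)^j + j. Finally x^m (1-x)^k = Σ_l C(m,l) (-1)^l (1-x)^(l+k), and every
-- exponent l + k is at least 2.
module Submission where

open import Defs

module VolkenbornIntegration where

  open import Data.Nat as ℕ using (ℕ; zero; suc; _∸_; _<_; _≤_; s≤s; z≤n; _^_; _≡ᵇ_)
  import Data.Nat.Properties as ℕP
  open import Data.Nat.Combinatorics using (_C_; nCn≡1; nC1≡n; nCk≡nC[n∸k])
  open import Data.Nat.Coprimality using (1-coprimeTo)
    renaming (sym to coprime-sym)
  open import Data.Integer as ℤ using (ℤ; -[1+_]) renaming (+_ to pos)
  import Data.Integer.Properties as ℤP
  open import Data.Rational as ℚ using (ℚ; mkℚ; 0ℚ; 1ℚ; _+_; _*_; _-_; -_)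
  import Data.Rational.Properties as ℚP
  open import Data.Rational.Unnormalised using (*≡*)
  import Data.Rational.Unnormalised.Properties as ℚᵘ
  open import Data.Rational.Solver using (module +-*-Solver)
  open +-*-Solver using (solve; _:=_; _:+_; _:*_; :-_; _:-_; con)
  open import Algebra.Bundles using (CommutativeRing)
  open CommutativeRing ℚP.+-*-commutativeRing using (semiring; commutativeSemiring)
  import Algebra.Properties.CommutativeSemiring.Binomial commutativeSemiring as ℚ-Binomial
  open import Algebra.Properties.Semiring.Exp semiring using () renaming (_^_ to _^ₛ_)
  open import Algebra.Properties.Semiring.Mult semiring using () renaming (_×_ to _×ₛ_)
  open import Algebra.Properties.Semiring.Sum semiring using (sum)
  open import Data.Fin using (Fin; toℕ)
  open import Data.Nat.Divisibility using (_∣_; divides; _∣?_; ∣1⇒≡1; 1∣_; ∣-trans; m∣m*n; *-monoʳ-∣; *-cancelˡ-∣)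
  open import Data.Nat.Primality using (Prime; euclidsLemma; prime⇒nonZero; prime⇒nonTrivial)
  open import Data.Nat.Induction using (<-rec)
  open import Data.Bool using (true; false)
  open import Data.Bool.Properties using (if-cong)
  open import Data.Sum using (inj₁; inj₂; [_,_]′)
  open import Data.Product using (Σ; _×_; _,_; proj₁; proj₂)
  open import Relation.Nullary using (¬_; yes; no; contradiction)
  open import Function using (_∘_)
  open import Relation.Binary.PropositionalEquality using (_≡_; refl; sym; trans; cong; cong₂; subst; module ≡-Reasoning)
  open ≡-Reasoning

  ℤ→ℚ : ℤ → ℚ
  ℤ→ℚ z = mkℚ z 0 (coprime-sym (1-coprimeTo _))

  ℤ→ℚ-+ : ∀ a b → ℤ→ℚ (a ℤ.+ b) ≡ ℤ→ℚ a + ℤ→ℚ b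
  ℤ→ℚ-+ a b = sym (trans
    (cong₂ (λ x y → (x ℤ.+ y) ℚ./ 1) (ℤP.*-identityʳ a) (ℤP.*-identityʳ b))
    (ℚP.↥p/↧p≡p (ℤ→ℚ (a ℤ.+ b))))

  ℤ→ℚ-* : ∀ a b → ℤ→ℚ (a ℤ.* b) ≡ ℤ→ℚ a * ℤ→ℚ b
  ℤ→ℚ-* a b = sym (ℚP.↥p/↧p≡p (ℤ→ℚ (a ℤ.* b)))

  ℤ→ℚ-neg : ∀ a → ℤ→ℚ (ℤ.- a) ≡ - ℤ→ℚ a
  ℤ→ℚ-neg (pos zero)    = refl
  ℤ→ℚ-neg (pos (suc n)) = refl
  ℤ→ℚ-neg -[1+ n ]      = refl

  ℕ→ℚ≡ℤ→ℚ : ∀ n → ℕ→ℚ n ≡ ℤ→ℚ (pos n)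
  ℕ→ℚ≡ℤ→ℚ n = ℚP.↥p/↧p≡p (ℤ→ℚ (pos n))

  ℕ→ℚ-+ : ∀ m n → ℕ→ℚ (m ℕ.+ n) ≡ ℕ→ℚ m + ℕ→ℚ n
  ℕ→ℚ-+ m n = begin
    ℕ→ℚ (m ℕ.+ n)               ≡⟨ ℕ→ℚ≡ℤ→ℚ (m ℕ.+ n) ⟩
    ℤ→ℚ (pos (m ℕ.+ n))         ≡⟨ cong ℤ→ℚ (ℤP.pos-+ m n) ⟩
    ℤ→ℚ (pos m ℤ.+ pos n)       ≡⟨ ℤ→ℚ-+ (pos m) (pos n) ⟩
    ℤ→ℚ (pos m) + ℤ→ℚ (pos n)   ≡⟨ cong₂ _+_ (ℕ→ℚ≡ℤ→ℚ m) (ℕ→ℚ≡ℤ→ℚ n) ⟨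
    ℕ→ℚ m + ℕ→ℚ n               ∎

  ℕ→ℚ-* : ∀ m n → ℕ→ℚ (m ℕ.* n) ≡ ℕ→ℚ m * ℕ→ℚ n
  ℕ→ℚ-* m n = begin
    ℕ→ℚ (m ℕ.* n)               ≡⟨ ℕ→ℚ≡ℤ→ℚ (m ℕ.* n) ⟩
    ℤ→ℚ (pos (m ℕ.* n))         ≡⟨ cong ℤ→ℚ (ℤP.pos-* m n) ⟩
    ℤ→ℚ (pos m ℤ.* pos n)       ≡⟨ ℤ→ℚ-* (pos m) (pos n) ⟩
    ℤ→ℚ (pos m) * ℤ→ℚ (pos n)   ≡⟨ cong₂ _*_ (ℕ→ℚ≡ℤ→ℚ m) (ℕ→ℚ≡ℤ→ℚ n) ⟨
    ℕ→ℚ m * ℕ→ℚ n               ∎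

  ℕ→ℚ-suc : ∀ n → ℕ→ℚ (suc n) ≡ ℕ→ℚ n + 1ℚ
  ℕ→ℚ-suc n = trans (cong ℕ→ℚ (ℕP.+-comm 1 n)) (ℕ→ℚ-+ n 1)

  ℕ→ℚ-∸ : ∀ {m n} → n ≤ m → ℕ→ℚ (m ∸ n) ≡ ℕ→ℚ m - ℕ→ℚ n
  ℕ→ℚ-∸ {m} {n} n≤m = begin
    ℕ→ℚ (m ∸ n)                   ≡⟨ solve 2 (λ a b → a := a :+ b :- b) refl (ℕ→ℚ (m ∸ n)) (ℕ→ℚ n) ⟩
    ℕ→ℚ (m ∸ n) + ℕ→ℚ n - ℕ→ℚ n   ≡⟨ cong (_- ℕ→ℚ n) (ℕ→ℚ-+ (m ∸ n) n) ⟨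
    ℕ→ℚ (m ∸ n ℕ.+ n) - ℕ→ℚ n     ≡⟨ cong (λ k → ℕ→ℚ k - ℕ→ℚ n) (ℕP.m∸n+n≡m n≤m) ⟩
    ℕ→ℚ m - ℕ→ℚ n                 ∎

  ℕ→ℚ-*-inverse : ∀ n .{{_ : ℕ.NonZero n}} → ℕ→ℚ n * (pos 1 ℚ./ n) ≡ 1ℚ
  ℕ→ℚ-*-inverse (suc n) = trans
    (cong₂ _*_ (ℕ→ℚ≡ℤ→ℚ (suc n)) (ℚP.↥p/↧p≡p (ℚ.1/ ℤ→ℚ (pos (suc n)))))
    (ℚP.*-inverseʳ (ℤ→ℚ (pos (suc n))))

  numerator-cross : ∀ q b z → q * ℤ→ℚ b ≡ ℤ→ℚ z → ℚ.↥ q ℤ.* b ≡ z ℤ.* ℚ.↧ q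
  numerator-cross q@record{} b z qb≡z
    with ℚᵘ.≃-trans (ℚᵘ.≃-sym (ℚP.toℚᵘ-homo-* q (ℤ→ℚ b))) (ℚᵘ.≃-reflexive (cong ℚ.toℚᵘ qb≡z))
  ... | *≡* cross = begin
    ℚ.↥ q ℤ.* b                          ≡⟨ ℤP.*-identityʳ _ ⟨
    ℚ.↥ q ℤ.* b ℤ.* pos 1                ≡⟨ cross ⟩
    z ℤ.* pos (ℚ.↧ₙ q ℕ.* 1)             ≡⟨ cong (λ d → z ℤ.* pos d) (ℕP.*-identityʳ (ℚ.↧ₙ q)) ⟩
    z ℤ.* ℚ.↧ q                          ∎

  *-denominator≡numerator : ∀ q → q * ℤ→ℚ (ℚ.↧ q) ≡ ℤ→ℚ (ℚ.↥ q)
  *-denominator≡numerator q@record{} = ℚP.toℚᵘ-injective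
    (ℚᵘ.≃-trans (ℚP.toℚᵘ-homo-* q (ℤ→ℚ (ℚ.↧ q))) (*≡* (ℤP.*-assoc (ℚ.↥ q) (ℚ.↧ q) (pos 1))))

  ^ℚ-+ : ∀ x m n → x ^ℚ (m ℕ.+ n) ≡ x ^ℚ m * x ^ℚ n
  ^ℚ-+ x zero    n = sym (ℚP.*-identityˡ _)
  ^ℚ-+ x (suc m) n = trans (cong (x *_) (^ℚ-+ x m n)) (sym (ℚP.*-assoc x _ _))

  1^ℚ : ∀ n → 1ℚ ^ℚ n ≡ 1ℚ
  1^ℚ zero    = refl
  1^ℚ (suc n) = trans (ℚP.*-identityˡ _) (1^ℚ n)

  neg-^ℚ : ∀ x n → (- x) ^ℚ n ≡ sgn n * x ^ℚ n
  neg-^ℚ x zero    = refl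
  neg-^ℚ x (suc n) = trans (cong (- x *_) (neg-^ℚ x n))
    (solve 3 (λ x s y → (:- x) :* (s :* y) := (con (- 1ℚ) :* s) :* (x :* y)) refl x (sgn n) (x ^ℚ n))

  Σ<-cong : ∀ n {f g : ℕ → ℚ} → (∀ i → i < n → f i ≡ g i) → Σ< n f ≡ Σ< n g
  Σ<-cong zero    f≡g = refl
  Σ<-cong (suc n) f≡g = cong₂ _+_ (Σ<-cong n (λ i i<n → f≡g i (ℕP.m<n⇒m<1+n i<n))) (f≡g n ℕP.≤-refl)

  Σ<-zero : ∀ n → Σ< n (λ _ → 0ℚ) ≡ 0ℚ
  Σ<-zero zero    = refl
  Σ<-zero (suc n) = trans (ℚP.+-identityʳ _) (Σ<-zero n)

  Σ<-distrib-+ : ∀ n (f g : ℕ → ℚ) → Σ< n (λ i → f i + g i) ≡ Σ< n f + Σ< n g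
  Σ<-distrib-+ zero    f g = refl
  Σ<-distrib-+ (suc n) f g = trans (cong (_+ (f n + g n)) (Σ<-distrib-+ n f g))
    (solve 4 (λ a b c d → (a :+ b) :+ (c :+ d) := (a :+ c) :+ (b :+ d)) refl (Σ< n f) (Σ< n g) (f n) (g n))

  *-distribˡ-Σ< : ∀ n c (f : ℕ → ℚ) → c * Σ< n f ≡ Σ< n (λ i → c * f i)
  *-distribˡ-Σ< zero    c f = ℚP.*-zeroʳ c
  *-distribˡ-Σ< (suc n) c f = trans (ℚP.*-distribˡ-+ c (Σ< n f) (f n)) (cong (_+ c * f n) (*-distribˡ-Σ< n c f))

  Σ<-comm : ∀ m n (f : ℕ → ℕ → ℚ) → Σ< m (λ i → Σ< n (f i)) ≡ Σ< n (λ j → Σ< m (λ i → f i j))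
  Σ<-comm zero    n f = sym (Σ<-zero n)
  Σ<-comm (suc m) n f = trans (cong (_+ Σ< n (f m)) (Σ<-comm m n f)) (sym (Σ<-distrib-+ n _ (f m)))

  Σ<-head : ∀ n (f : ℕ → ℚ) → Σ< (suc n) f ≡ f 0 + Σ< n (λ i → f (suc i))
  Σ<-head zero    f = trans (ℚP.+-identityˡ (f 0)) (sym (ℚP.+-identityʳ (f 0)))
  Σ<-head (suc n) f = trans (cong (_+ f (suc n)) (Σ<-head n f)) (ℚP.+-assoc (f 0) _ (f (suc n)))

  Σ<-shift : ∀ n (f : ℕ → ℚ) → Σ< n (λ i → f (suc i)) ≡ Σ< n f - f 0 + f n
  Σ<-shift n f = begin
    Σ< n (λ i → f (suc i))                ≡⟨ solve 2 (λ a s → s := a :+ s :- a) refl (f 0) _ ⟩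
    f 0 + Σ< n (λ i → f (suc i)) - f 0    ≡⟨ cong (_- f 0) (Σ<-head n f) ⟨
    Σ< n f + f n - f 0                    ≡⟨ solve 3 (λ s a b → s :+ b :- a := s :- a :+ b) refl (Σ< n f) (f 0) (f n) ⟩
    Σ< n f - f 0 + f n                    ∎

  Σ<-telescope : ∀ n (f : ℕ → ℚ) → Σ< n (λ i → f (suc i) - f i) ≡ f n - f 0
  Σ<-telescope zero    f = sym (ℚP.+-inverseʳ (f 0))
  Σ<-telescope (suc n) f = trans (cong (_+ (f (suc n) - f n)) (Σ<-telescope n f))
    (solve 3 (λ a b c → b :- a :+ (c :- b) := c :- a) refl (f 0) (f n) (f (suc n)))

  Σ<-reverse : ∀ n (f : ℕ → ℚ) → Σ< n (λ i → f (n ∸ suc i)) ≡ Σ< n f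
  Σ<-reverse zero    f = refl
  Σ<-reverse (suc n) f = begin
    Σ< (suc n) (λ i → f (n ∸ i))           ≡⟨ Σ<-head n (λ i → f (n ∸ i)) ⟩
    f n + Σ< n (λ i → f (n ∸ suc i))       ≡⟨ cong (f n +_) (Σ<-reverse n f) ⟩
    f n + Σ< n f                           ≡⟨ ℚP.+-comm (f n) (Σ< n f) ⟩
    Σ< (suc n) f                           ∎

  Σ<-reflect : ∀ m j → Σ< m (λ x → (- ℕ→ℚ x) ^ℚ j) ≡ Σ< m (λ x → (ℕ→ℚ (suc x) - ℕ→ℚ m) ^ℚ j)
  Σ<-reflect m j = trans (sym (Σ<-reverse m (λ x → (- ℕ→ℚ x) ^ℚ j))) (Σ<-cong m (λ x x<m →
    cong (_^ℚ j) (trans (cong -_ (ℕ→ℚ-∸ x<m))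
      (solve 2 (λ a b → :- (b :- a) := a :- b) refl (ℕ→ℚ (suc x)) (ℕ→ℚ m)))))

  Σ<-one-minus : ∀ m j → Σ< m (λ x → (1ℚ - ℕ→ℚ x) ^ℚ j)
                         ≡ Σ< m (λ x → (- ℕ→ℚ x) ^ℚ j) + (1ℚ ^ℚ j - (1ℚ - ℕ→ℚ m) ^ℚ j)
  Σ<-one-minus m j = begin
    Σ< m g                              ≡⟨ solve 3 (λ s a b → s := s :- a :+ b :+ (a :- b)) refl (Σ< m g) (g 0) (g m) ⟩
    Σ< m g - g 0 + g m + (g 0 - g m)    ≡⟨ cong (_+ (g 0 - g m)) (Σ<-shift m g) ⟨
    Σ< m (λ x → g (suc x)) + (g 0 - g m) ≡⟨ cong (_+ (1ℚ ^ℚ j - g m)) (Σ<-cong m (λ x _ → cong (_^ℚ j) (shifted x))) ⟩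
    Σ< m (λ x → (- ℕ→ℚ x) ^ℚ j) + (1ℚ ^ℚ j - g m) ∎
    where
    g : ℕ → ℚ
    g x = (1ℚ - ℕ→ℚ x) ^ℚ j
    shifted : ∀ x → 1ℚ - ℕ→ℚ (suc x) ≡ - ℕ→ℚ x
    shifted x = trans (cong (λ y → 1ℚ - y) (ℕ→ℚ-suc x)) (solve 1 (λ a → con 1ℚ :- (a :+ con 1ℚ) := :- a) refl (ℕ→ℚ x))

  ^ℚ≡^ : ∀ x n → x ^ℚ n ≡ x ^ₛ n
  ^ℚ≡^ x zero    = refl
  ^ℚ≡^ x (suc n) = cong (x *_) (^ℚ≡^ x n)

  ×ₛ≡ℕ→ℚ* : ∀ n x → n ×ₛ x ≡ ℕ→ℚ n * x
  ×ₛ≡ℕ→ℚ* zero    x = sym (ℚP.*-zeroˡ x)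
  ×ₛ≡ℕ→ℚ* (suc n) x = begin
    x + n ×ₛ x                ≡⟨ cong (x +_) (×ₛ≡ℕ→ℚ* n x) ⟩
    x + ℕ→ℚ n * x             ≡⟨ solve 2 (λ x m → x :+ m :* x := (m :+ con 1ℚ) :* x) refl x (ℕ→ℚ n) ⟩
    (ℕ→ℚ n + 1ℚ) * x          ≡⟨ cong (_* x) (ℕ→ℚ-suc n) ⟨
    ℕ→ℚ (suc n) * x           ∎

  Σ<≡sum : ∀ n (f : ℕ → ℚ) → Σ< n f ≡ sum (λ (i : Fin n) → f (toℕ i))
  Σ<≡sum zero    f = refl
  Σ<≡sum (suc n) f = trans (Σ<-head n f) (cong (f 0 +_) (Σ<≡sum n (λ i → f (suc i))))

  binomial : ∀ n z → (z + 1ℚ) ^ℚ n ≡ Σ< (suc n) (λ i → ℕ→ℚ (n C i) * z ^ℚ i)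
  binomial n z = begin
    (z + 1ℚ) ^ℚ n                 ≡⟨ ^ℚ≡^ (z + 1ℚ) n ⟩
    (z + 1ℚ) ^ₛ n                 ≡⟨ ℚ-Binomial.theorem n z 1ℚ ⟩
    ℚ-Binomial.binomialExpansion z 1ℚ n
      ≡⟨ Σ<≡sum (suc n) (λ i → (n C i) ×ₛ (z ^ₛ i * 1ℚ ^ₛ (n ∸ i))) ⟨
    Σ< (suc n) (λ i → (n C i) ×ₛ (z ^ₛ i * 1ℚ ^ₛ (n ∸ i)))
      ≡⟨ Σ<-cong (suc n) (λ i _ → term i) ⟩
    Σ< (suc n) (λ i → ℕ→ℚ (n C i) * z ^ℚ i) ∎
    where
    term : ∀ i → (n C i) ×ₛ (z ^ₛ i * 1ℚ ^ₛ (n ∸ i)) ≡ ℕ→ℚ (n C i) * z ^ℚ i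
    term i = begin
      (n C i) ×ₛ (z ^ₛ i * 1ℚ ^ₛ (n ∸ i))      ≡⟨ ×ₛ≡ℕ→ℚ* (n C i) _ ⟩
      ℕ→ℚ (n C i) * (z ^ₛ i * 1ℚ ^ₛ (n ∸ i))   ≡⟨ cong₂ (λ a b → ℕ→ℚ (n C i) * (a * b)) (^ℚ≡^ z i) (^ℚ≡^ 1ℚ (n ∸ i)) ⟨
      ℕ→ℚ (n C i) * (z ^ℚ i * 1ℚ ^ℚ (n ∸ i))   ≡⟨ cong (λ a → ℕ→ℚ (n C i) * (z ^ℚ i * a)) (1^ℚ (n ∸ i)) ⟩
      ℕ→ℚ (n C i) * (z ^ℚ i * 1ℚ)              ≡⟨ cong (ℕ→ℚ (n C i) *_) (ℚP.*-identityʳ _) ⟩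
      ℕ→ℚ (n C i) * z ^ℚ i                     ∎

  binomial-difference : ∀ n z → (z + 1ℚ) ^ℚ suc n - z ^ℚ suc n ≡ Σ< (suc n) (λ i → ℕ→ℚ (suc n C i) * z ^ℚ i)
  binomial-difference n z = begin
    (z + 1ℚ) ^ℚ suc n - z ^ℚ suc n
      ≡⟨ cong (_- z ^ℚ suc n) (binomial (suc n) z) ⟩
    Σ< (suc n) (λ i → ℕ→ℚ (suc n C i) * z ^ℚ i) + ℕ→ℚ (suc n C suc n) * z ^ℚ suc n - z ^ℚ suc n
      ≡⟨ cong (λ c → Σ< (suc n) (λ i → ℕ→ℚ (suc n C i) * z ^ℚ i) + ℕ→ℚ c * z ^ℚ suc n - z ^ℚ suc n) (nCn≡1 (suc n)) ⟩
    Σ< (suc n) (λ i → ℕ→ℚ (suc n C i) * z ^ℚ i) + 1ℚ * z ^ℚ suc n - z ^ℚ suc n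
      ≡⟨ solve 2 (λ s y → s :+ con 1ℚ :* y :- y := s) refl _ (z ^ℚ suc n) ⟩
    Σ< (suc n) (λ i → ℕ→ℚ (suc n C i) * z ^ℚ i) ∎

  power-product-expansion : ∀ m k y → y ^ℚ m * (1ℚ - y) ^ℚ k
                                      ≡ Σ< (suc m) (λ l → (ℕ→ℚ (m C l) * sgn l) * (1ℚ - y) ^ℚ (l ℕ.+ k))
  power-product-expansion m k y = begin
    y ^ℚ m * w ^ℚ k                                         ≡⟨ cong (λ u → u ^ℚ m * w ^ℚ k) (solve 1 (λ y → y := :- (con 1ℚ :- y) :+ con 1ℚ) refl y) ⟩
    (- w + 1ℚ) ^ℚ m * w ^ℚ k                                ≡⟨ cong (_* w ^ℚ k) (binomial m (- w)) ⟩
    Σ< (suc m) (λ l → ℕ→ℚ (m C l) * (- w) ^ℚ l) * w ^ℚ k    ≡⟨ ℚP.*-comm _ (w ^ℚ k) ⟩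
    w ^ℚ k * Σ< (suc m) (λ l → ℕ→ℚ (m C l) * (- w) ^ℚ l)    ≡⟨ *-distribˡ-Σ< (suc m) (w ^ℚ k) _ ⟩
    Σ< (suc m) (λ l → w ^ℚ k * (ℕ→ℚ (m C l) * (- w) ^ℚ l))  ≡⟨ Σ<-cong (suc m) (λ l _ → term l) ⟩
    Σ< (suc m) (λ l → (ℕ→ℚ (m C l) * sgn l) * w ^ℚ (l ℕ.+ k)) ∎
    where
    w = 1ℚ - y
    term : ∀ l → w ^ℚ k * (ℕ→ℚ (m C l) * (- w) ^ℚ l) ≡ (ℕ→ℚ (m C l) * sgn l) * w ^ℚ (l ℕ.+ k)
    term l = begin
      w ^ℚ k * (ℕ→ℚ (m C l) * (- w) ^ℚ l)       ≡⟨ cong (λ u → w ^ℚ k * (ℕ→ℚ (m C l) * u)) (neg-^ℚ w l) ⟩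
      w ^ℚ k * (ℕ→ℚ (m C l) * (sgn l * w ^ℚ l)) ≡⟨ solve 4 (λ a c s b → a :* (c :* (s :* b)) := (c :* s) :* (b :* a)) refl (w ^ℚ k) (ℕ→ℚ (m C l)) (sgn l) (w ^ℚ l) ⟩
      (ℕ→ℚ (m C l) * sgn l) * (w ^ℚ l * w ^ℚ k) ≡⟨ cong ((ℕ→ℚ (m C l) * sgn l) *_) (^ℚ-+ w l k) ⟨
      (ℕ→ℚ (m C l) * sgn l) * w ^ℚ (l ℕ.+ k)    ∎

  -- Power sums and Bernoulli numbers

  power-sum-recurrence : ∀ n m →
    Σ< (suc n) (λ i → ℕ→ℚ (suc n C i) * Σ< m (λ x → ℕ→ℚ x ^ℚ i)) ≡ ℕ→ℚ m ^ℚ suc n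
  power-sum-recurrence n m = begin
    Σ< (suc n) (λ i → ℕ→ℚ (suc n C i) * Σ< m (λ x → ℕ→ℚ x ^ℚ i))
      ≡⟨ Σ<-cong (suc n) (λ i _ → *-distribˡ-Σ< m (ℕ→ℚ (suc n C i)) _) ⟩
    Σ< (suc n) (λ i → Σ< m (λ x → ℕ→ℚ (suc n C i) * ℕ→ℚ x ^ℚ i))
      ≡⟨ Σ<-comm (suc n) m _ ⟩
    Σ< m (λ x → Σ< (suc n) (λ i → ℕ→ℚ (suc n C i) * ℕ→ℚ x ^ℚ i))
      ≡⟨ Σ<-cong m (λ x _ → trans (sym (binomial-difference n (ℕ→ℚ x)))
                              (cong (λ y → y ^ℚ suc n - ℕ→ℚ x ^ℚ suc n) (sym (ℕ→ℚ-suc x)))) ⟩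
    Σ< m (λ x → ℕ→ℚ (suc x) ^ℚ suc n - ℕ→ℚ x ^ℚ suc n)
      ≡⟨ Σ<-telescope m (λ x → ℕ→ℚ x ^ℚ suc n) ⟩
    ℕ→ℚ m ^ℚ suc n - 0ℚ * 0ℚ ^ℚ n
      ≡⟨ cong (λ y → ℕ→ℚ m ^ℚ suc n - y) (ℚP.*-zeroˡ (0ℚ ^ℚ n)) ⟩
    ℕ→ℚ m ^ℚ suc n - 0ℚ
      ≡⟨ ℚP.+-identityʳ _ ⟩
    ℕ→ℚ m ^ℚ suc n ∎

  [1+n]Cn≡1+n : ∀ n → suc n C n ≡ suc n
  [1+n]Cn≡1+n n = begin
    suc n C n                ≡⟨ nCk≡nC[n∸k] (ℕP.n≤1+n n) ⟩
    suc n C (suc n ∸ n)      ≡⟨ cong (suc n C_) (ℕP.m+n∸n≡m 1 n) ⟩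
    suc n C 1                ≡⟨ nC1≡n (suc n) ⟩
    suc n                    ∎

  ≡ᵇ-refl : ∀ n → (n ≡ᵇ n) ≡ true
  ≡ᵇ-refl zero    = refl
  ≡ᵇ-refl (suc n) = ≡ᵇ-refl n

  ≤⇒≡ᵇ-suc-false : ∀ {i n} → i ≤ n → (i ≡ᵇ suc n) ≡ false
  ≤⇒≡ᵇ-suc-false z≤n       = refl
  ≤⇒≡ᵇ-suc-false (s≤s i≤n) = ≤⇒≡ᵇ-suc-false i≤n

  bernTable-step : ∀ {m i} → i ≤ m → bernTable (suc m) i ≡ bernTable m i
  bernTable-step i≤m = if-cong (≤⇒≡ᵇ-suc-false i≤m)

  bernTable-stable : ∀ {m i} → i ≤ m → bernTable m i ≡ bernoulli i
  bernTable-stable {zero}  z≤n = refl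
  bernTable-stable {suc m} {i} i≤1+m with ℕP.m≤n⇒m<n∨m≡n i≤1+m
  ... | inj₂ refl      = refl
  ... | inj₁ (s≤s i≤m) = trans (bernTable-step i≤m) (bernTable-stable i≤m)

  bernoulli-suc : ∀ n → ℕ→ℚ (suc (suc n)) * bernoulli (suc n)
                        ≡ - Σ< (suc n) (λ i → ℕ→ℚ (suc (suc n) C i) * bernoulli i)
  bernoulli-suc n = begin
    N * bernoulli (suc n)
      ≡⟨ cong (N *_) (if-cong (≡ᵇ-refl n)) ⟩
    N * - (N⁻¹ * Σ< (suc n) (λ i → c i * bernTable n i))
      ≡⟨ cong (λ s → N * - (N⁻¹ * s)) (Σ<-cong (suc n) (λ i i<1+n → cong (c i *_) (bernTable-stable (ℕP.<⇒≤pred i<1+n)))) ⟩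
    N * - (N⁻¹ * S)
      ≡⟨ solve 3 (λ a b s → a :* (:- (b :* s)) := :- ((a :* b) :* s)) refl N N⁻¹ S ⟩
    - ((N * N⁻¹) * S)
      ≡⟨ cong (λ u → - (u * S)) (ℕ→ℚ-*-inverse (suc (suc n))) ⟩
    - (1ℚ * S)
      ≡⟨ cong -_ (ℚP.*-identityˡ S) ⟩
    - S ∎
    where
    N = ℕ→ℚ (suc (suc n))
    N⁻¹ = pos 1 ℚ./ suc (suc n)
    c : ℕ → ℚ
    c i = ℕ→ℚ (suc (suc n) C i)
    S = Σ< (suc n) (λ i → c i * bernoulli i)

  bernoulli-recurrence : ∀ n → Σ< (suc n) (λ i → ℕ→ℚ (suc n C i) * bernoulli i) ≡ 0ℚ ^ℚ n
  bernoulli-recurrence zero    = refl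
  bernoulli-recurrence (suc n) = begin
    S + ℕ→ℚ (suc (suc n) C suc n) * bernoulli (suc n)
      ≡⟨ cong (λ c → S + ℕ→ℚ c * bernoulli (suc n)) ([1+n]Cn≡1+n (suc n)) ⟩
    S + ℕ→ℚ (suc (suc n)) * bernoulli (suc n)
      ≡⟨ cong (S +_) (bernoulli-suc n) ⟩
    S - S
      ≡⟨ ℚP.+-inverseʳ S ⟩
    0ℚ
      ≡⟨ ℚP.*-zeroˡ (0ℚ ^ℚ n) ⟨
    0ℚ ^ℚ suc n ∎
    where
    S = Σ< (suc n) (λ i → ℕ→ℚ (suc (suc n) C i) * bernoulli i)

  module PAdic (p : ℕ) (p-prime : Prime p) where

    instance
      p≢0 : ℕ.NonZero p
      p≢0 = prime⇒nonZero p-prime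

    pᴺ : ℕ → ℚ
    pᴺ N = ℕ→ℚ (p ^ N)

    p⁻ᴺ : ℕ → ℚ
    p⁻ᴺ N = (pos 1 ℚ./ p ^ N) {{ℕP.m^n≢0 p N}}

    pᴺ-*-p⁻ᴺ : ∀ N → pᴺ N * p⁻ᴺ N ≡ 1ℚ
    pᴺ-*-p⁻ᴺ N = ℕ→ℚ-*-inverse (p ^ N) {{ℕP.m^n≢0 p N}}

    pᴺ-+ : ∀ m n → pᴺ (m ℕ.+ n) ≡ pᴺ m * pᴺ n
    pᴺ-+ m n = trans (cong ℕ→ℚ (ℕP.^-distribˡ-+-* p m n)) (ℕ→ℚ-* (p ^ m) (p ^ n))

    -- p-integral rationals

    p∤1 : ¬ p ∣ 1
    p∤1 p∣1 = ℕ.nonTrivial⇒≢1 {{prime⇒nonTrivial p-prime}} (∣1⇒≡1 p∣1)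

    p∤-* : ∀ {m n} → ¬ p ∣ m → ¬ p ∣ n → ¬ p ∣ m ℕ.* n
    p∤-* p∤m p∤n p∣mn = [ p∤m , p∤n ]′ (euclidsLemma _ _ p-prime p∣mn)

    record _∈ℤ₍ₚ₎ (q : ℚ) : Set where
      constructor fraction
      field
        numerator denominator : ℤ
        p∤denominator : ¬ p ∣ ℤ.∣ denominator ∣
        q*denominator≡numerator : q * ℤ→ℚ denominator ≡ ℤ→ℚ numerator

    ℤ→ℚ-∈ℤ₍ₚ₎ : ∀ z → ℤ→ℚ z ∈ℤ₍ₚ₎
    ℤ→ℚ-∈ℤ₍ₚ₎ z = fraction z (pos 1) p∤1 (ℚP.*-identityʳ _)

    ℕ→ℚ-∈ℤ₍ₚ₎ : ∀ n → ℕ→ℚ n ∈ℤ₍ₚ₎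
    ℕ→ℚ-∈ℤ₍ₚ₎ n = subst _∈ℤ₍ₚ₎ (sym (ℕ→ℚ≡ℤ→ℚ n)) (ℤ→ℚ-∈ℤ₍ₚ₎ (pos n))

    neg-∈ℤ₍ₚ₎ : ∀ {x} → x ∈ℤ₍ₚ₎ → (- x) ∈ℤ₍ₚ₎
    neg-∈ℤ₍ₚ₎ {x} (fraction a b p∤b xb≡a) = fraction (ℤ.- a) b p∤b (begin
      - x * ℤ→ℚ b        ≡⟨ ℚP.neg-distribˡ-* x (ℤ→ℚ b) ⟨
      - (x * ℤ→ℚ b)      ≡⟨ cong -_ xb≡a ⟩
      - ℤ→ℚ a            ≡⟨ ℤ→ℚ-neg a ⟨
      ℤ→ℚ (ℤ.- a)        ∎)

    +-∈ℤ₍ₚ₎ : ∀ {x y} → x ∈ℤ₍ₚ₎ → y ∈ℤ₍ₚ₎ → (x + y) ∈ℤ₍ₚ₎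
    +-∈ℤ₍ₚ₎ {x} {y} (fraction a b p∤b xb≡a) (fraction c d p∤d yd≡c) =
      fraction (a ℤ.* d ℤ.+ c ℤ.* b) (b ℤ.* d) (p∤-* p∤b p∤d ∘ subst (p ∣_) (ℤP.abs-* b d)) (begin
        (x + y) * ℤ→ℚ (b ℤ.* d)                   ≡⟨ cong ((x + y) *_) (ℤ→ℚ-* b d) ⟩
        (x + y) * (ℤ→ℚ b * ℤ→ℚ d)                 ≡⟨ solve 4 (λ x y b d → (x :+ y) :* (b :* d) := (x :* b) :* d :+ (y :* d) :* b) refl x y (ℤ→ℚ b) (ℤ→ℚ d) ⟩
        (x * ℤ→ℚ b) * ℤ→ℚ d + (y * ℤ→ℚ d) * ℤ→ℚ b ≡⟨ cong₂ (λ u v → u * ℤ→ℚ d + v * ℤ→ℚ b) xb≡a yd≡c ⟩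
        ℤ→ℚ a * ℤ→ℚ d + ℤ→ℚ c * ℤ→ℚ b             ≡⟨ cong₂ _+_ (ℤ→ℚ-* a d) (ℤ→ℚ-* c b) ⟨
        ℤ→ℚ (a ℤ.* d) + ℤ→ℚ (c ℤ.* b)             ≡⟨ ℤ→ℚ-+ (a ℤ.* d) (c ℤ.* b) ⟨
        ℤ→ℚ (a ℤ.* d ℤ.+ c ℤ.* b)                 ∎)

    *-∈ℤ₍ₚ₎ : ∀ {x y} → x ∈ℤ₍ₚ₎ → y ∈ℤ₍ₚ₎ → (x * y) ∈ℤ₍ₚ₎
    *-∈ℤ₍ₚ₎ {x} {y} (fraction a b p∤b xb≡a) (fraction c d p∤d yd≡c) =
      fraction (a ℤ.* c) (b ℤ.* d) (p∤-* p∤b p∤d ∘ subst (p ∣_) (ℤP.abs-* b d)) (begin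
        (x * y) * ℤ→ℚ (b ℤ.* d)             ≡⟨ cong ((x * y) *_) (ℤ→ℚ-* b d) ⟩
        (x * y) * (ℤ→ℚ b * ℤ→ℚ d)           ≡⟨ solve 4 (λ x y b d → (x :* y) :* (b :* d) := (x :* b) :* (y :* d)) refl x y (ℤ→ℚ b) (ℤ→ℚ d) ⟩
        (x * ℤ→ℚ b) * (y * ℤ→ℚ d)           ≡⟨ cong₂ _*_ xb≡a yd≡c ⟩
        ℤ→ℚ a * ℤ→ℚ c                       ≡⟨ ℤ→ℚ-* a c ⟨
        ℤ→ℚ (a ℤ.* c)                       ∎)

    ^-∈ℤ₍ₚ₎ : ∀ {x} → x ∈ℤ₍ₚ₎ → ∀ n → (x ^ℚ n) ∈ℤ₍ₚ₎
    ^-∈ℤ₍ₚ₎ x∈ zero    = ℕ→ℚ-∈ℤ₍ₚ₎ 1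
    ^-∈ℤ₍ₚ₎ x∈ (suc n) = *-∈ℤ₍ₚ₎ x∈ (^-∈ℤ₍ₚ₎ x∈ n)

    PPowerDecomposition : ℕ → Set
    PPowerDecomposition n = Σ ℕ λ t → Σ ℕ λ w → n ≡ p ^ t ℕ.* w × ¬ p ∣ w

    split-p-power : ∀ d → PPowerDecomposition (suc d)
    split-p-power = <-rec (PPowerDecomposition ∘ suc) split
      where
      split : ∀ d → (∀ {d′} → d′ < d → PPowerDecomposition (suc d′)) → PPowerDecomposition (suc d)
      split d rec with p ∣? suc d
      ... | no p∤1+d = 0 , suc d , sym (ℕP.*-identityˡ (suc d)) , p∤1+d
      ... | yes (divides (suc q) 1+d≡[1+q]p) with rec (ℕP.≤-pred (subst (suc q <_) (sym 1+d≡[1+q]p)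
                                                   (ℕP.m<m*n (suc q) p (ℕ.nonTrivial⇒n>1 p {{prime⇒nonTrivial p-prime}}))))
      ... | t , w , 1+q≡p^t*w , p∤w = suc t , w , (begin
        suc d                    ≡⟨ 1+d≡[1+q]p ⟩
        suc q ℕ.* p              ≡⟨ cong (ℕ._* p) 1+q≡p^t*w ⟩
        p ^ t ℕ.* w ℕ.* p        ≡⟨ ℕP.*-comm (p ^ t ℕ.* w) p ⟩
        p ℕ.* (p ^ t ℕ.* w)      ≡⟨ ℕP.*-assoc p (p ^ t) w ⟨
        p ^ suc t ℕ.* w          ∎) , p∤w

    p-power-clears-denominator : ∀ c → Σ ℕ λ t → (pᴺ t * c) ∈ℤ₍ₚ₎
    p-power-clears-denominator c@(mkℚ u d-1 _) with split-p-power d-1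
    ... | t , w , 1+d-1≡p^t*w , p∤w = t , fraction u (pos w) p∤w (begin
      pᴺ t * c * ℤ→ℚ (pos w)              ≡⟨ solve 3 (λ P c W → P :* c :* W := c :* (P :* W)) refl (pᴺ t) c (ℤ→ℚ (pos w)) ⟩
      c * (pᴺ t * ℤ→ℚ (pos w))            ≡⟨ cong (λ P → c * (P * ℤ→ℚ (pos w))) (ℕ→ℚ≡ℤ→ℚ (p ^ t)) ⟩
      c * (ℤ→ℚ (pos (p ^ t)) * ℤ→ℚ (pos w)) ≡⟨ cong (c *_) (ℤ→ℚ-* (pos (p ^ t)) (pos w)) ⟨
      c * ℤ→ℚ (pos (p ^ t) ℤ.* pos w)     ≡⟨ cong (λ k → c * ℤ→ℚ k) (ℤP.pos-* (p ^ t) w) ⟨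
      c * ℤ→ℚ (pos (p ^ t ℕ.* w))         ≡⟨ cong (λ k → c * ℤ→ℚ (pos k)) 1+d-1≡p^t*w ⟨
      c * ℤ→ℚ (pos (suc d-1))             ≡⟨ *-denominator≡numerator c ⟩
      ℤ→ℚ u                               ∎)

    infix 4 p^_∣_
    record p^_∣_ (e : ℕ) (q : ℚ) : Set where
      constructor multiple
      field
        cofactor : ℚ
        cofactor-∈ℤ₍ₚ₎ : cofactor ∈ℤ₍ₚ₎
        q≡pᴺ*cofactor : q ≡ pᴺ e * cofactor

    p^∣-0 : ∀ e → p^ e ∣ 0ℚ
    p^∣-0 e = multiple 0ℚ (ℕ→ℚ-∈ℤ₍ₚ₎ 0) (sym (ℚP.*-zeroʳ (pᴺ e)))

    p^N∣pᴺ : ∀ N → p^ N ∣ pᴺ N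
    p^N∣pᴺ N = multiple 1ℚ (ℕ→ℚ-∈ℤ₍ₚ₎ 1) (sym (ℚP.*-identityʳ (pᴺ N)))

    p^∣-+ : ∀ {e x y} → p^ e ∣ x → p^ e ∣ y → p^ e ∣ x + y
    p^∣-+ {e} (multiple r r∈ refl) (multiple s s∈ refl) = multiple (r + s) (+-∈ℤ₍ₚ₎ r∈ s∈) (sym (ℚP.*-distribˡ-+ (pᴺ e) r s))

    p^∣-neg : ∀ {e x} → p^ e ∣ x → p^ e ∣ - x
    p^∣-neg {e} (multiple r r∈ refl) = multiple (- r) (neg-∈ℤ₍ₚ₎ r∈) (ℚP.neg-distribʳ-* (pᴺ e) r)

    p^∣-scale : ∀ {e c x} → c ∈ℤ₍ₚ₎ → p^ e ∣ x → p^ e ∣ c * x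
    p^∣-scale {e} {c} c∈ (multiple r r∈ refl) =
      multiple (c * r) (*-∈ℤ₍ₚ₎ c∈ r∈) (solve 3 (λ c P r → c :* (P :* r) := P :* (c :* r)) refl c (pᴺ e) r)

    p^∣-* : ∀ {e f x y} → p^ e ∣ x → p^ f ∣ y → p^ (e ℕ.+ f) ∣ x * y
    p^∣-* {e} {f} (multiple r r∈ refl) (multiple s s∈ refl) = multiple (r * s) (*-∈ℤ₍ₚ₎ r∈ s∈) (begin
      pᴺ e * r * (pᴺ f * s)   ≡⟨ solve 4 (λ P r Q s → P :* r :* (Q :* s) := P :* Q :* (r :* s)) refl (pᴺ e) r (pᴺ f) s ⟩
      pᴺ e * pᴺ f * (r * s)   ≡⟨ cong (_* (r * s)) (pᴺ-+ e f) ⟨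
      pᴺ (e ℕ.+ f) * (r * s)  ∎)

    p^∣-weaken : ∀ {e f x} → e ≤ f → p^ f ∣ x → p^ e ∣ x
    p^∣-weaken {e} {f} e≤f (multiple r r∈ refl) = multiple (pᴺ (f ∸ e) * r) (*-∈ℤ₍ₚ₎ (ℕ→ℚ-∈ℤ₍ₚ₎ (p ^ (f ∸ e))) r∈) (begin
      pᴺ f * r                      ≡⟨ cong (λ k → pᴺ k * r) (ℕP.m+[n∸m]≡n e≤f) ⟨
      pᴺ (e ℕ.+ (f ∸ e)) * r        ≡⟨ cong (_* r) (pᴺ-+ e (f ∸ e)) ⟩
      pᴺ e * pᴺ (f ∸ e) * r         ≡⟨ ℚP.*-assoc (pᴺ e) _ r ⟩
      pᴺ e * (pᴺ (f ∸ e) * r)       ∎)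

    p^∣⇒∈ℤ₍ₚ₎ : ∀ {e x} → p^ e ∣ x → x ∈ℤ₍ₚ₎
    p^∣⇒∈ℤ₍ₚ₎ {e} (multiple r r∈ refl) = *-∈ℤ₍ₚ₎ (ℕ→ℚ-∈ℤ₍ₚ₎ (p ^ e)) r∈

    p^∣-Σ< : ∀ {e} n {f : ℕ → ℚ} → (∀ i → p^ e ∣ f i) → p^ e ∣ Σ< n f
    p^∣-Σ< {e} zero    p^e∣f = p^∣-0 e
    p^∣-Σ< (suc n) p^e∣f = p^∣-+ (p^∣-Σ< n p^e∣f) (p^e∣f n)

    p^∣-p⁻ᴺ : ∀ {e x} N → p^ (e ℕ.+ N) ∣ x → p^ e ∣ p⁻ᴺ N * x
    p^∣-p⁻ᴺ {e} N (multiple r r∈ refl) = multiple r r∈ (begin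
      p⁻ᴺ N * (pᴺ (e ℕ.+ N) * r)       ≡⟨ cong (λ P → p⁻ᴺ N * (P * r)) (pᴺ-+ e N) ⟩
      p⁻ᴺ N * (pᴺ e * pᴺ N * r)        ≡⟨ solve 4 (λ Q P R r → Q :* (P :* R :* r) := (R :* Q) :* (P :* r)) refl (p⁻ᴺ N) (pᴺ e) (pᴺ N) r ⟩
      (pᴺ N * p⁻ᴺ N) * (pᴺ e * r)      ≡⟨ cong (_* (pᴺ e * r)) (pᴺ-*-p⁻ᴺ N) ⟩
      1ℚ * (pᴺ e * r)                  ≡⟨ ℚP.*-identityˡ _ ⟩
      pᴺ e * r                         ∎)

    p^∣-scale-rational : ∀ {e t c x} → (pᴺ t * c) ∈ℤ₍ₚ₎ → p^ (e ℕ.+ t) ∣ x → p^ e ∣ c * x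
    p^∣-scale-rational {e} {t} {c} pᴺc∈ (multiple r r∈ refl) = multiple (pᴺ t * c * r) (*-∈ℤ₍ₚ₎ pᴺc∈ r∈) (begin
      c * (pᴺ (e ℕ.+ t) * r)     ≡⟨ cong (λ P → c * (P * r)) (pᴺ-+ e t) ⟩
      c * (pᴺ e * pᴺ t * r)      ≡⟨ solve 4 (λ c P Q r → c :* (P :* Q :* r) := P :* (Q :* c :* r)) refl c (pᴺ e) (pᴺ t) r ⟩
      pᴺ e * (pᴺ t * c * r)      ∎)

    p^e∣m*n⇒p^e∣m : ∀ e {m n} → ¬ p ∣ n → p ^ e ∣ m ℕ.* n → p ^ e ∣ m
    p^e∣m*n⇒p^e∣m zero    {m} p∤n _ = 1∣ m
    p^e∣m*n⇒p^e∣m (suc e) {m} {n} p∤n p^e∣mn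
      with euclidsLemma m n p-prime (∣-trans (m∣m*n (p ^ e)) p^e∣mn)
    ... | inj₂ p∣n = contradiction p∣n p∤n
    ... | inj₁ (divides m′ refl) =
      subst (p ^ suc e ∣_) (ℕP.*-comm p m′) (*-monoʳ-∣ p (p^e∣m*n⇒p^e∣m e p∤n (*-cancelˡ-∣ p p*p^e∣p*m′n)))
      where
      p*p^e∣p*m′n : p ℕ.* p ^ e ∣ p ℕ.* (m′ ℕ.* n)
      p*p^e∣p*m′n = subst (p ℕ.* p ^ e ∣_) (trans (cong (ℕ._* n) (ℕP.*-comm m′ p)) (ℕP.*-assoc p m′ n)) p^e∣mn

    p^∣⇒PAdicSmall : ∀ {e q} → p^ e ∣ q → PAdicSmall p e q
    p^∣⇒PAdicSmall {e} {q} (multiple r (fraction a b p∤b rb≡a) refl) =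
      p^e∣m*n⇒p^e∣m e p∤b (subst (p ^ e ∣_) ∣↥q*b∣≡ (m∣m*n (ℤ.∣ a ℤ.* ℚ.↧ q ∣)))
      where
      qb≡p^e*a : q * ℤ→ℚ b ≡ ℤ→ℚ (pos (p ^ e) ℤ.* a)
      qb≡p^e*a = begin
        pᴺ e * r * ℤ→ℚ b             ≡⟨ ℚP.*-assoc (pᴺ e) r (ℤ→ℚ b) ⟩
        pᴺ e * (r * ℤ→ℚ b)           ≡⟨ cong₂ _*_ (ℕ→ℚ≡ℤ→ℚ (p ^ e)) rb≡a ⟩
        ℤ→ℚ (pos (p ^ e)) * ℤ→ℚ a    ≡⟨ ℤ→ℚ-* (pos (p ^ e)) a ⟨
        ℤ→ℚ (pos (p ^ e) ℤ.* a)      ∎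
      ∣↥q*b∣≡ : p ^ e ℕ.* ℤ.∣ a ℤ.* ℚ.↧ q ∣ ≡ ℤ.∣ ℚ.↥ q ∣ ℕ.* ℤ.∣ b ∣
      ∣↥q*b∣≡ = begin
        p ^ e ℕ.* ℤ.∣ a ℤ.* ℚ.↧ q ∣            ≡⟨ ℤP.abs-* (pos (p ^ e)) (a ℤ.* ℚ.↧ q) ⟨
        ℤ.∣ pos (p ^ e) ℤ.* (a ℤ.* ℚ.↧ q) ∣    ≡⟨ cong ℤ.∣_∣ (ℤP.*-assoc (pos (p ^ e)) a (ℚ.↧ q)) ⟨
        ℤ.∣ pos (p ^ e) ℤ.* a ℤ.* ℚ.↧ q ∣      ≡⟨ cong ℤ.∣_∣ (numerator-cross q b _ qb≡p^e*a) ⟨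
        ℤ.∣ ℚ.↥ q ℤ.* b ∣                      ≡⟨ ℤP.abs-* (ℚ.↥ q) b ⟩
        ℤ.∣ ℚ.↥ q ∣ ℕ.* ℤ.∣ b ∣                ∎

    pow-taylor : ∀ {e z h} → z ∈ℤ₍ₚ₎ → p^ e ∣ h → ∀ j →
      p^ (e ℕ.+ e) ∣ (z + h) ^ℚ j - z ^ℚ j - ℕ→ℚ j * h * z ^ℚ (j ∸ 1)
    pow-taylor {e} {z} {h} z∈ p^e∣h zero =
      subst (p^ (e ℕ.+ e) ∣_) (solve 1 (λ h → con 0ℚ := con 1ℚ :- con 1ℚ :- con 0ℚ :* h :* con 1ℚ) refl h) (p^∣-0 _)
    pow-taylor {e} {z} {h} z∈ p^e∣h (suc zero) =
      subst (p^ (e ℕ.+ e) ∣_) (solve 2 (λ z h → con 0ℚ := (z :+ h) :* con 1ℚ :- z :* con 1ℚ :- con 1ℚ :* h :* con 1ℚ) refl z h) (p^∣-0 _)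
    pow-taylor {e} {z} {h} z∈ p^e∣h (suc (suc i)) = subst (p^ (e ℕ.+ e) ∣_) step
      (p^∣-+ (p^∣-scale (+-∈ℤ₍ₚ₎ z∈ (p^∣⇒∈ℤ₍ₚ₎ p^e∣h)) (pow-taylor z∈ p^e∣h (suc i)))
             (p^∣-scale (*-∈ℤ₍ₚ₎ (ℕ→ℚ-∈ℤ₍ₚ₎ (suc i)) (^-∈ℤ₍ₚ₎ z∈ i)) (p^∣-* p^e∣h p^e∣h)))
      where
      K = ℕ→ℚ (suc i)
      step : (z + h) * ((z + h) ^ℚ suc i - z ^ℚ suc i - K * h * z ^ℚ i) + K * z ^ℚ i * (h * h)
             ≡ (z + h) ^ℚ suc (suc i) - z ^ℚ suc (suc i) - ℕ→ℚ (suc (suc i)) * h * z ^ℚ suc i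
      step = begin
        (z + h) * ((z + h) ^ℚ suc i - z * z ^ℚ i - K * h * z ^ℚ i) + K * z ^ℚ i * (h * h)
          ≡⟨ solve 5 (λ z h K A Z → (z :+ h) :* (A :- z :* Z :- K :* h :* Z) :+ K :* Z :* (h :* h)
                                   := (z :+ h) :* A :- z :* (z :* Z) :- (K :+ con 1ℚ) :* h :* (z :* Z))
                     refl z h K ((z + h) ^ℚ suc i) (z ^ℚ i) ⟩
        (z + h) * (z + h) ^ℚ suc i - z * (z * z ^ℚ i) - (K + 1ℚ) * h * (z * z ^ℚ i)
          ≡⟨ cong (λ k → (z + h) * (z + h) ^ℚ suc i - z * (z * z ^ℚ i) - k * h * (z * z ^ℚ i)) (ℕ→ℚ-suc (suc i)) ⟨
        (z + h) ^ℚ suc (suc i) - z ^ℚ suc (suc i) - ℕ→ℚ (suc (suc i)) * h * z ^ℚ suc i ∎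

    difference-quotient : ∀ {z} → z ∈ℤ₍ₚ₎ → ∀ j N →
      p^ N ∣ p⁻ᴺ N * ((z - pᴺ N) ^ℚ j - z ^ℚ j) + ℕ→ℚ j * z ^ℚ (j ∸ 1)
    difference-quotient {z} z∈ j N = subst (p^ N ∣_) quotient
      (p^∣-p⁻ᴺ N (pow-taylor z∈ (p^∣-neg (p^N∣pᴺ N)) j))
      where
      J = ℕ→ℚ j
      Z = z ^ℚ (j ∸ 1)
      quotient : p⁻ᴺ N * ((z - pᴺ N) ^ℚ j - z ^ℚ j - J * (- pᴺ N) * Z) ≡ p⁻ᴺ N * ((z - pᴺ N) ^ℚ j - z ^ℚ j) + J * Z
      quotient = begin
        p⁻ᴺ N * ((z - pᴺ N) ^ℚ j - z ^ℚ j - J * (- pᴺ N) * Z)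
          ≡⟨ solve 6 (λ q a b j P Z → q :* (a :- b :- j :* (:- P) :* Z) := q :* (a :- b) :+ (P :* q) :* (j :* Z))
                     refl (p⁻ᴺ N) ((z - pᴺ N) ^ℚ j) (z ^ℚ j) J (pᴺ N) Z ⟩
        p⁻ᴺ N * ((z - pᴺ N) ^ℚ j - z ^ℚ j) + (pᴺ N * p⁻ᴺ N) * (J * Z)
          ≡⟨ cong (λ u → p⁻ᴺ N * ((z - pᴺ N) ^ℚ j - z ^ℚ j) + u * (J * Z)) (pᴺ-*-p⁻ᴺ N) ⟩
        p⁻ᴺ N * ((z - pᴺ N) ^ℚ j - z ^ℚ j) + 1ℚ * (J * Z)
          ≡⟨ cong (p⁻ᴺ N * ((z - pᴺ N) ^ℚ j - z ^ℚ j) +_) (ℚP.*-identityˡ (J * Z)) ⟩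
        p⁻ᴺ N * ((z - pᴺ N) ^ℚ j - z ^ℚ j) + J * Z ∎

    -- p-adic convergence

    infix 4 _→ₚ_
    record _→ₚ_ (a : ℕ → ℚ) (L : ℚ) : Set where
      constructor limit
      field
        threshold : ∀ e → Σ ℕ λ N₀ → ∀ N → N₀ ≤ N → p^ e ∣ a N - L
    open _→ₚ_

    →ₚ⇒PAdicLimit : ∀ {a L} → a →ₚ L → PAdicLimit p a L
    →ₚ⇒PAdicLimit a→L e = proj₁ (threshold a→L e) , λ N N₀≤N → p^∣⇒PAdicSmall (proj₂ (threshold a→L e) N N₀≤N)

    →ₚ-cong : ∀ {a b L M} → (∀ N → a N ≡ b N) → L ≡ M → a →ₚ L → b →ₚ M
    →ₚ-cong {L = L} a≗b refl a→L = limit λ e → let (N₀ , conv) = threshold a→L e in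
      N₀ , λ N N₀≤N → subst (λ x → p^ e ∣ x - L) (a≗b N) (conv N N₀≤N)

    →ₚ-const : ∀ c → (λ _ → c) →ₚ c
    →ₚ-const c = limit λ e → 0 , λ _ _ → subst (p^ e ∣_) (sym (ℚP.+-inverseʳ c)) (p^∣-0 e)

    →ₚ-+ : ∀ {a b L M} → a →ₚ L → b →ₚ M → (λ N → a N + b N) →ₚ L + M
    →ₚ-+ {a} {b} {L} {M} a→L b→M = limit λ e →
      let (N₁ , conv₁) = threshold a→L e
          (N₂ , conv₂) = threshold b→M e
      in N₁ ℕ.⊔ N₂ , λ N N₁⊔N₂≤N →
        subst (p^ e ∣_) (solve 4 (λ x y l m → (x :- l) :+ (y :- m) := (x :+ y) :- (l :+ m)) refl (a N) (b N) L M)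
          (p^∣-+ (conv₁ N (ℕP.m⊔n≤o⇒m≤o N₁ N₂ N₁⊔N₂≤N)) (conv₂ N (ℕP.m⊔n≤o⇒n≤o N₁ N₂ N₁⊔N₂≤N)))

    →ₚ-neg : ∀ {a L} → a →ₚ L → (λ N → - a N) →ₚ - L
    →ₚ-neg {a} {L} a→L = limit λ e → let (N₀ , conv) = threshold a→L e in
      N₀ , λ N N₀≤N → subst (p^ e ∣_) (solve 2 (λ x l → :- (x :- l) := (:- x) :- (:- l)) refl (a N) L) (p^∣-neg (conv N N₀≤N))

    →ₚ-- : ∀ {a b L M} → a →ₚ L → b →ₚ M → (λ N → a N - b N) →ₚ L - M
    →ₚ-- a→L b→M = →ₚ-+ a→L (→ₚ-neg b→M)

    →ₚ-scale : ∀ c {a L} → a →ₚ L → (λ N → c * a N) →ₚ c * L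
    →ₚ-scale c {a} {L} a→L = limit λ e → let (N₀ , conv) = threshold a→L (e ℕ.+ t) in
      N₀ , λ N N₀≤N → subst (p^ e ∣_) (solve 3 (λ c x l → c :* (x :- l) := c :* x :- c :* l) refl c (a N) L)
        (p^∣-scale-rational pᴺc∈ (conv N N₀≤N))
      where
      t = proj₁ (p-power-clears-denominator c)
      pᴺc∈ = proj₂ (p-power-clears-denominator c)

    →ₚ-Σ< : ∀ n {a : ℕ → ℕ → ℚ} {L : ℕ → ℚ} → (∀ i → i < n → a i →ₚ L i) → (λ N → Σ< n (λ i → a i N)) →ₚ Σ< n L
    →ₚ-Σ< zero    a→L = →ₚ-const 0ℚ
    →ₚ-Σ< (suc n) a→L = →ₚ-+ (→ₚ-Σ< n (λ i i<n → a→L i (ℕP.m<n⇒m<1+n i<n))) (a→L n ℕP.≤-refl)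

    →ₚ-0 : ∀ {a} → (∀ N → p^ N ∣ a N) → a →ₚ 0ℚ
    →ₚ-0 {a} p^N∣a = limit λ e → e , λ N e≤N →
      subst (p^ e ∣_) (sym (ℚP.+-identityʳ (a N))) (p^∣-weaken e≤N (p^N∣a N))

    pᴺ^→ₚ : ∀ n → (λ N → pᴺ N ^ℚ n) →ₚ 0ℚ ^ℚ n
    pᴺ^→ₚ zero    = →ₚ-const 1ℚ
    pᴺ^→ₚ (suc n) = →ₚ-cong (λ _ → refl) (sym (ℚP.*-zeroˡ (0ℚ ^ℚ n)))
      (→ₚ-0 λ N → subst (p^ N ∣_) (ℚP.*-comm (pᴺ N ^ℚ n) (pᴺ N))
                    (p^∣-scale (^-∈ℤ₍ₚ₎ (ℕ→ℚ-∈ℤ₍ₚ₎ (p ^ N)) n) (p^N∣pᴺ N)))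

    →ₚ-pᴺ* : ∀ {a L} → a →ₚ L → (λ N → pᴺ N * a N) →ₚ 0ℚ
    →ₚ-pᴺ* {a} {L} a→L = →ₚ-cong (λ N → solve 3 (λ P x l → P :* (x :- l) :+ l :* P := P :* x) refl (pᴺ N) (a N) L)
        (trans (ℚP.+-identityˡ (L * 0ℚ)) (ℚP.*-zeroʳ L))
        (→ₚ-+ small (→ₚ-scale L (→ₚ-0 p^N∣pᴺ)))
      where
      small : (λ N → pᴺ N * (a N - L)) →ₚ 0ℚ
      small = limit λ e → let (N₀ , conv) = threshold a→L e in
        N₀ , λ N N₀≤N → subst (p^ e ∣_) (sym (ℚP.+-identityʳ _))
          (p^∣-weaken (ℕP.m≤n+m e N) (p^∣-* (p^N∣pᴺ N) (conv N N₀≤N)))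

    →ₚ-cancel : ∀ n {a L} → (λ N → ℕ→ℚ (suc n) * a N) →ₚ ℕ→ℚ (suc n) * L → a →ₚ L
    →ₚ-cancel n {a} {L} ca→cL = →ₚ-cong (λ N → cancel (a N)) (cancel L) (→ₚ-scale c⁻¹ ca→cL)
      where
      c = ℕ→ℚ (suc n)
      c⁻¹ = pos 1 ℚ./ suc n
      cancel : ∀ x → c⁻¹ * (c * x) ≡ x
      cancel x = begin
        c⁻¹ * (c * x)     ≡⟨ solve 3 (λ d c x → d :* (c :* x) := (c :* d) :* x) refl c⁻¹ c x ⟩
        (c * c⁻¹) * x     ≡⟨ cong (_* x) (ℕ→ℚ-*-inverse (suc n)) ⟩
        1ℚ * x            ≡⟨ ℚP.*-identityˡ x ⟩
        x                 ∎

    -- Volkenborn integrals of polynomials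

    pᴺ*volkenbornSum : ∀ f N → pᴺ N * volkenbornSum p f N ≡ Σ< (p ^ N) f
    pᴺ*volkenbornSum f N = begin
      pᴺ N * (p⁻ᴺ N * Σ< (p ^ N) f)    ≡⟨ ℚP.*-assoc (pᴺ N) (p⁻ᴺ N) _ ⟨
      pᴺ N * p⁻ᴺ N * Σ< (p ^ N) f      ≡⟨ cong (_* Σ< (p ^ N) f) (pᴺ-*-p⁻ᴺ N) ⟩
      1ℚ * Σ< (p ^ N) f                ≡⟨ ℚP.*-identityˡ _ ⟩
      Σ< (p ^ N) f                     ∎

    volkenbornSum-linear : ∀ n (c : ℕ → ℚ) (f : ℕ → ℕ → ℚ) N →
      volkenbornSum p (λ x → Σ< n (λ l → c l * f l x)) N ≡ Σ< n (λ l → c l * volkenbornSum p (f l) N)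
    volkenbornSum-linear n c f N = begin
      p⁻ᴺ N * Σ< (p ^ N) (λ x → Σ< n (λ l → c l * f l x))
        ≡⟨ cong (p⁻ᴺ N *_) (Σ<-comm (p ^ N) n _) ⟩
      p⁻ᴺ N * Σ< n (λ l → Σ< (p ^ N) (λ x → c l * f l x))
        ≡⟨ *-distribˡ-Σ< n (p⁻ᴺ N) _ ⟩
      Σ< n (λ l → p⁻ᴺ N * Σ< (p ^ N) (λ x → c l * f l x))
        ≡⟨ Σ<-cong n (λ l _ → trans (cong (p⁻ᴺ N *_) (sym (*-distribˡ-Σ< (p ^ N) (c l) (f l))))
                              (solve 3 (λ q c s → q :* (c :* s) := c :* (q :* s)) refl (p⁻ᴺ N) (c l) _)) ⟩
      Σ< n (λ l → c l * (p⁻ᴺ N * Σ< (p ^ N) (f l))) ∎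

    volkenbornSum-power-recurrence : ∀ n N →
      Σ< (suc n) (λ i → ℕ→ℚ (suc n C i) * volkenbornSum p (λ x → ℕ→ℚ x ^ℚ i) N) ≡ pᴺ N ^ℚ n
    volkenbornSum-power-recurrence n N = begin
      Σ< (suc n) (λ i → c i * (p⁻ᴺ N * S i))
        ≡⟨ Σ<-cong (suc n) (λ i _ → solve 3 (λ c q s → c :* (q :* s) := q :* (c :* s)) refl (c i) (p⁻ᴺ N) (S i)) ⟩
      Σ< (suc n) (λ i → p⁻ᴺ N * (c i * S i))
        ≡⟨ *-distribˡ-Σ< (suc n) (p⁻ᴺ N) _ ⟨
      p⁻ᴺ N * Σ< (suc n) (λ i → c i * S i)
        ≡⟨ cong (p⁻ᴺ N *_) (power-sum-recurrence n (p ^ N)) ⟩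
      p⁻ᴺ N * (pᴺ N * pᴺ N ^ℚ n)
        ≡⟨ solve 3 (λ q P z → q :* (P :* z) := (P :* q) :* z) refl (p⁻ᴺ N) (pᴺ N) (pᴺ N ^ℚ n) ⟩
      (pᴺ N * p⁻ᴺ N) * pᴺ N ^ℚ n
        ≡⟨ cong (_* pᴺ N ^ℚ n) (pᴺ-*-p⁻ᴺ N) ⟩
      1ℚ * pᴺ N ^ℚ n
        ≡⟨ ℚP.*-identityˡ _ ⟩
      pᴺ N ^ℚ n ∎
      where
      c S : ℕ → ℚ
      c i = ℕ→ℚ (suc n C i)
      S i = Σ< (p ^ N) (λ x → ℕ→ℚ x ^ℚ i)

    volkenborn-monomial : ∀ n → volkenbornSum p (λ x → ℕ→ℚ x ^ℚ n) →ₚ bernoulli n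
    volkenborn-monomial = <-rec _ step
      where
      step : ∀ n → (∀ {i} → i < n → volkenbornSum p (λ x → ℕ→ℚ x ^ℚ i) →ₚ bernoulli i) →
             volkenbornSum p (λ x → ℕ→ℚ x ^ℚ n) →ₚ bernoulli n
      step n ih = →ₚ-cancel n (→ₚ-cong
          (λ N → last-term (volkenbornSum-power-recurrence n N))
          (last-term (bernoulli-recurrence n))
          (→ₚ-- (pᴺ^→ₚ n) (→ₚ-Σ< n (λ i i<n → →ₚ-scale (ℕ→ℚ (suc n C i)) (ih i<n)))))
        where
        last-term : ∀ {a : ℕ → ℚ} {y} → Σ< (suc n) (λ i → ℕ→ℚ (suc n C i) * a i) ≡ y →
                    y - Σ< n (λ i → ℕ→ℚ (suc n C i) * a i) ≡ ℕ→ℚ (suc n) * a n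
        last-term {a} refl = begin
          S + ℕ→ℚ (suc n C n) * a n - S    ≡⟨ solve 2 (λ s t → s :+ t :- s := t) refl S _ ⟩
          ℕ→ℚ (suc n C n) * a n            ≡⟨ cong (λ k → ℕ→ℚ k * a n) ([1+n]Cn≡1+n n) ⟩
          ℕ→ℚ (suc n) * a n                ∎
          where
          S = Σ< n (λ i → ℕ→ℚ (suc n C i) * a i)

    volkenborn-shifted-monomial : ∀ n → volkenbornSum p (λ x → ℕ→ℚ (suc x) ^ℚ suc n) →ₚ bernoulli (suc n) + 0ℚ ^ℚ n
    volkenborn-shifted-monomial n = →ₚ-cong (λ N → sym (shift N)) refl (→ₚ-+ (volkenborn-monomial (suc n)) (pᴺ^→ₚ n))
      where
      shift : ∀ N → volkenbornSum p (λ x → ℕ→ℚ (suc x) ^ℚ suc n) N ≡ volkenbornSum p (λ x → ℕ→ℚ x ^ℚ suc n) N + pᴺ N ^ℚ n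
      shift N = begin
        p⁻ᴺ N * Σ< (p ^ N) (λ x → ℕ→ℚ (suc x) ^ℚ suc n)
          ≡⟨ cong (p⁻ᴺ N *_) (Σ<-shift (p ^ N) (λ x → ℕ→ℚ x ^ℚ suc n)) ⟩
        p⁻ᴺ N * (S - 0ℚ * 0ℚ ^ℚ n + pᴺ N * pᴺ N ^ℚ n)
          ≡⟨ solve 5 (λ q S z P y → q :* (S :- con 0ℚ :* z :+ P :* y) := q :* S :+ (P :* q) :* y) refl (p⁻ᴺ N) S (0ℚ ^ℚ n) (pᴺ N) (pᴺ N ^ℚ n) ⟩
        p⁻ᴺ N * S + (pᴺ N * p⁻ᴺ N) * pᴺ N ^ℚ n
          ≡⟨ cong (λ u → p⁻ᴺ N * S + u * pᴺ N ^ℚ n) (pᴺ-*-p⁻ᴺ N) ⟩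
        p⁻ᴺ N * S + 1ℚ * pᴺ N ^ℚ n
          ≡⟨ cong (p⁻ᴺ N * S +_) (ℚP.*-identityˡ _) ⟩
        p⁻ᴺ N * S + pᴺ N ^ℚ n ∎
        where
        S = Σ< (p ^ N) (λ x → ℕ→ℚ x ^ℚ suc n)

    volkenborn-reflection : ∀ n → volkenbornSum p (λ x → (- ℕ→ℚ x) ^ℚ suc (suc n)) →ₚ bernoulli (suc (suc n))
    volkenborn-reflection n = →ₚ-cong (λ N → sym (reflect N)) limit-value
      (→ₚ-+ (volkenborn-shifted-monomial (suc n))
            (→ₚ-+ (→ₚ-scale (- J) (→ₚ-pᴺ* (volkenborn-shifted-monomial n)))
                  (→ₚ-0 λ N → p^∣-Σ< (p ^ N) (λ x → difference-quotient (ℕ→ℚ-∈ℤ₍ₚ₎ (suc x)) j N))))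
      where
      j = suc (suc n)
      J = ℕ→ℚ j
      z : ℕ → ℚ
      z x = ℕ→ℚ (suc x)
      E : ℕ → ℕ → ℚ
      E N x = p⁻ᴺ N * ((z x - pᴺ N) ^ℚ j - z x ^ℚ j) + J * z x ^ℚ suc n
      limit-value : bernoulli j + 0ℚ ^ℚ suc n + (- J * 0ℚ + 0ℚ) ≡ bernoulli j
      limit-value = solve 3 (λ b u J → b :+ con 0ℚ :* u :+ (:- J :* con 0ℚ :+ con 0ℚ) := b) refl (bernoulli j) (0ℚ ^ℚ n) J
      reflect : ∀ N → volkenbornSum p (λ x → (- ℕ→ℚ x) ^ℚ j) N
                      ≡ volkenbornSum p (λ x → z x ^ℚ j) N
                        + (- J * (pᴺ N * volkenbornSum p (λ x → z x ^ℚ suc n) N) + Σ< (p ^ N) (E N))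
      reflect N = begin
        p⁻ᴺ N * Σ< (p ^ N) (λ x → (- ℕ→ℚ x) ^ℚ j)
          ≡⟨ cong (p⁻ᴺ N *_) (Σ<-reflect (p ^ N) j) ⟩
        p⁻ᴺ N * Σ< (p ^ N) (λ x → (z x - pᴺ N) ^ℚ j)
          ≡⟨ *-distribˡ-Σ< (p ^ N) (p⁻ᴺ N) _ ⟩
        Σ< (p ^ N) (λ x → p⁻ᴺ N * (z x - pᴺ N) ^ℚ j)
          ≡⟨ Σ<-cong (p ^ N) (λ x _ → solve 5 (λ q a b J y → q :* a := q :* b :+ (:- J :* y :+ (q :* (a :- b) :+ J :* y))) refl
                                        (p⁻ᴺ N) ((z x - pᴺ N) ^ℚ j) (z x ^ℚ j) J (z x ^ℚ suc n)) ⟩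
        Σ< (p ^ N) (λ x → p⁻ᴺ N * z x ^ℚ j + (- J * z x ^ℚ suc n + E N x))
          ≡⟨ Σ<-distrib-+ (p ^ N) _ _ ⟩
        Σ< (p ^ N) (λ x → p⁻ᴺ N * z x ^ℚ j) + Σ< (p ^ N) (λ x → - J * z x ^ℚ suc n + E N x)
          ≡⟨ cong (Σ< (p ^ N) (λ x → p⁻ᴺ N * z x ^ℚ j) +_) (Σ<-distrib-+ (p ^ N) _ _) ⟩
        Σ< (p ^ N) (λ x → p⁻ᴺ N * z x ^ℚ j) + (Σ< (p ^ N) (λ x → - J * z x ^ℚ suc n) + Σ< (p ^ N) (E N))
          ≡⟨ cong₂ (λ a b → a + (b + Σ< (p ^ N) (E N))) (*-distribˡ-Σ< (p ^ N) (p⁻ᴺ N) _) (*-distribˡ-Σ< (p ^ N) (- J) _) ⟨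
        p⁻ᴺ N * Σ< (p ^ N) (λ x → z x ^ℚ j) + (- J * Σ< (p ^ N) (λ x → z x ^ℚ suc n) + Σ< (p ^ N) (E N))
          ≡⟨ cong (λ s → p⁻ᴺ N * Σ< (p ^ N) (λ x → z x ^ℚ j) + (- J * s + Σ< (p ^ N) (E N)))
                  (pᴺ*volkenbornSum (λ x → z x ^ℚ suc n) N) ⟨
        p⁻ᴺ N * Σ< (p ^ N) (λ x → z x ^ℚ j) + (- J * (pᴺ N * volkenbornSum p (λ x → z x ^ℚ suc n) N) + Σ< (p ^ N) (E N)) ∎

    volkenborn-one-minus : ∀ {j} → 1 < j → volkenbornSum p (λ x → (1ℚ - ℕ→ℚ x) ^ℚ j) →ₚ bernoulli j + ℕ→ℚ j
    volkenborn-one-minus {suc (suc n)} (s≤s (s≤s z≤n)) = →ₚ-cong (λ N → sym (shift N)) limit-value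
      (→ₚ-+ (volkenborn-reflection n) (→ₚ-- (→ₚ-const (J * 1ℚ ^ℚ suc n)) (→ₚ-0 (difference-quotient (ℕ→ℚ-∈ℤ₍ₚ₎ 1) j))))
      where
      j = suc (suc n)
      J = ℕ→ℚ j
      E : ℕ → ℚ
      E N = p⁻ᴺ N * ((1ℚ - pᴺ N) ^ℚ j - 1ℚ ^ℚ j) + J * 1ℚ ^ℚ suc n
      limit-value : bernoulli j + (J * 1ℚ ^ℚ suc n - 0ℚ) ≡ bernoulli j + J
      limit-value = trans (cong (λ u → bernoulli j + (J * u - 0ℚ)) (1^ℚ (suc n)))
        (solve 2 (λ b J → b :+ (J :* con 1ℚ :- con 0ℚ) := b :+ J) refl (bernoulli j) J)
      shift : ∀ N → volkenbornSum p (λ x → (1ℚ - ℕ→ℚ x) ^ℚ j) N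
                    ≡ volkenbornSum p (λ x → (- ℕ→ℚ x) ^ℚ j) N + (J * 1ℚ ^ℚ suc n - E N)
      shift N = begin
        p⁻ᴺ N * Σ< (p ^ N) (λ x → (1ℚ - ℕ→ℚ x) ^ℚ j)
          ≡⟨ cong (p⁻ᴺ N *_) (Σ<-one-minus (p ^ N) j) ⟩
        p⁻ᴺ N * (Σ< (p ^ N) (λ x → (- ℕ→ℚ x) ^ℚ j) + (1ℚ ^ℚ j - (1ℚ - pᴺ N) ^ℚ j))
          ≡⟨ solve 6 (λ q s a b J u → q :* (s :+ (a :- b)) := q :* s :+ (J :* u :- (q :* (b :- a) :+ J :* u))) refl
               (p⁻ᴺ N) _ (1ℚ ^ℚ j) ((1ℚ - pᴺ N) ^ℚ j) J (1ℚ ^ℚ suc n) ⟩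
        p⁻ᴺ N * Σ< (p ^ N) (λ x → (- ℕ→ℚ x) ^ℚ j) + (J * 1ℚ ^ℚ suc n - E N) ∎

    volkenborn-power-product : ∀ m k → 1 < k →
      volkenbornSum p (λ x → ℕ→ℚ x ^ℚ m * (1ℚ - ℕ→ℚ x) ^ℚ k) →ₚ
        Σ< (suc m) (λ l → (ℕ→ℚ (m C l) * sgn l) * (bernoulli (l ℕ.+ k) + ℕ→ℚ (l ℕ.+ k)))
    volkenborn-power-product m k 1<k = →ₚ-cong (λ N → sym (expand N)) refl
      (→ₚ-Σ< (suc m) (λ l _ → →ₚ-scale (c l) (volkenborn-one-minus (ℕP.<-≤-trans 1<k (ℕP.m≤n+m k l)))))
      where
      c : ℕ → ℚ
      c l = ℕ→ℚ (m C l) * sgn l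
      expand : ∀ N → volkenbornSum p (λ x → ℕ→ℚ x ^ℚ m * (1ℚ - ℕ→ℚ x) ^ℚ k) N
                     ≡ Σ< (suc m) (λ l → c l * volkenbornSum p (λ x → (1ℚ - ℕ→ℚ x) ^ℚ (l ℕ.+ k)) N)
      expand N = trans (cong (p⁻ᴺ N *_) (Σ<-cong (p ^ N) (λ x _ → power-product-expansion m k (ℕ→ℚ x))))
                       (volkenbornSum-linear (suc m) c (λ l x → (1ℚ - ℕ→ℚ x) ^ℚ (l ℕ.+ k)) N)

open import Data.Nat using (ℕ; _<_; _≤_; _∸_; _+_; NonZero)
open import Data.Nat.Primality using (Prime)
open import Data.Nat.Combinatorics using (_C_)
open import Data.Rational using (ℚ; 1ℚ; _*_; _-_)
open import Data.Rational using () renaming (_+_ to _+ℚ_)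
open import Data.Nat.Properties using (+-comm)
open import Relation.Binary.PropositionalEquality using (refl; cong)

mainTheorem3 : (p : ℕ) → .{{_ : NonZero p}} → Prime p → (n k : ℕ) → 1 < k → k ≤ n →
    VolkenbornIntegral p (λ x → (ℕ→ℚ x ^ℚ (n ∸ k)) * ((1ℚ - ℕ→ℚ x) ^ℚ k))
    (Σ< (n ∸ k + 1) (λ l → (ℕ→ℚ ((n ∸ k) C l) * sgn l) * (bernoulli (l + k) +ℚ ℕ→ℚ (l + k))))
mainTheorem3 p p-prime n k 1<k _ = →ₚ⇒PAdicLimit
  (→ₚ-cong (λ _ → refl) (cong (λ t → Σ< t term) (+-comm 1 (n ∸ k))) (volkenborn-power-product (n ∸ k) k 1<k))
  where
  open VolkenbornIntegration.PAdic p p-prime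
  term : ℕ → ℚ
  term l = (ℕ→ℚ ((n ∸ k) C l) * sgn l) * (bernoulli (l + k) +ℚ ℕ→ℚ (l + k))
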